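{- For any simple graph $G=(V,E)$ with $V=[n]$, $$\Psi(G,x)=\sum_{D\in\mathcal{AO}(G)}\Psi(D,x).$$
   Context: $\mathcal{AO}(G)$ is the set of acyclic orientations of $G$ (digraphs on $V=[n]$ with the same vertex labels). $\delta_G(u,v)=1$ if $u<v$ or $uv\in E$, else $0$; for an ordering $\pi=(u_1,\dots,u_n)$ of $V$, $\delta_G(\pi)=\sum_{i=1}^{n-1}\delta_G(u_i,u_{i+1})$; $\Psi(G,x)=\sum_{\pi}\binom{x+\delta_G(\pi)}{n}$ over all $n!$ orderings $\pi$ of $V$, where $\binom{x+k}{n}=(x+k)\cdots(x+k-n+1)/n!$. For an acyclic digraph $D$ on $[n]$ with arc set $A$: $\mathcal{OP}(D)$ is the set of orderings $(u_1,\dots,u_n)$ with $(u_i,u_j)\in A\Rightarrow i<j$; $\delta_D(a,b)=1$ if $a<b$ or $(a,b)\in A$, else $0$; $\delta_D(\pi)=\sum_i\delta_D(u_i,u_{i+1})$; $\Psi(D,x)=\sum_{\pi\in\mathcal{OP}(D)}\binom{x+\delta_D(\pi)}{n}$. -}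

module Defs where

open import Data.Nat using (ℕ; zero; suc; _+_)
open import Data.Nat.Combinatorics using (_C_)
open import Data.Bool using (Bool; true; false; _∧_; _∨_; not; if_then_else_)
open import Data.Fin using (Fin; _<?_; _≟_)
open import Data.List using (List; []; _∷_; map; allFin; concatMap)
open import Data.Nat.ListAction using (sum)
open import Data.Vec using (Vec; lookup)
open import Data.Product using (_×_)
open import Data.Sum using (_⊎_)
open import Relation.Nullary using (¬_)
open import Relation.Nullary.Decidable using (⌊_⌋)
open import Relation.Binary.PropositionalEquality using (_≡_)

record SimpleGraph (n : ℕ) : Set where
  field
    adj   : Fin n → Fin n → Bool
    sym   : ∀ u v → adj u v ≡ adj v u
    irrefl : ∀ v → adj v v ≡ false
open SimpleGraph public

Edge : ∀ {n} → SimpleGraph n → Fin n → Fin n → Set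
Edge G u v = adj G u v ≡ true

Digraph : ℕ → Set
Digraph n = Vec (Vec Bool n) n

arc? : ∀ {n} → Digraph n → Fin n → Fin n → Bool
arc? D a b = lookup (lookup D a) b

Arc : ∀ {n} → Digraph n → Fin n → Fin n → Set
Arc D a b = arc? D a b ≡ true

data Path {n : ℕ} (D : Digraph n) : Fin n → Fin n → Set where
  step : ∀ {a b} → Arc D a b → Path D a b
  _∷ₚ_ : ∀ {a b c} → Arc D a b → Path D b c → Path D a c

Acyclic : ∀ {n} → Digraph n → Set
Acyclic D = ∀ v → ¬ Path D v v

IsOrientation : ∀ {n} → SimpleGraph n → Digraph n → Set
IsOrientation G D =
  ∀ u v → (Arc D u v → Edge G u v)
        × (Edge G u v → Arc D u v ⊎ Arc D v u)
        × ¬ (Arc D u v × Arc D v u)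

IsAcyclicOrientation : ∀ {n} → SimpleGraph n → Digraph n → Set
IsAcyclicOrientation G D = IsOrientation G D × Acyclic D

allᵇ : {A : Set} → (A → Bool) → List A → Bool
allᵇ p []       = true
allᵇ p (x ∷ xs) = p x ∧ allᵇ p xs

filterᵇ : {A : Set} → (A → Bool) → List A → List A
filterᵇ p []       = []
filterᵇ p (x ∷ xs) = if p x then x ∷ filterᵇ p xs else filterᵇ p xs

words : ∀ {n} → ℕ → List (List (Fin n))
words {n} zero    = [] ∷ []
words {n} (suc k) = concatMap (λ u → map (u ∷_) (words k)) (allFin n)

distinct : ∀ {n} → List (Fin n) → Bool
distinct []       = true
distinct (u ∷ us) = allᵇ (λ w → not ⌊ u ≟ w ⌋) us ∧ distinct us

orderings : (n : ℕ) → List (List (Fin n))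
orderings n = filterᵇ distinct (words n)

δsum : ∀ {n} → (Fin n → Fin n → Bool) → List (Fin n) → ℕ
δsum δ []           = 0
δsum δ (u ∷ [])     = 0
δsum δ (u ∷ v ∷ us) = (if δ u v then 1 else 0) + δsum δ (v ∷ us)

δG : ∀ {n} → SimpleGraph n → Fin n → Fin n → Bool
δG G u v = ⌊ u <? v ⌋ ∨ adj G u v

δD : ∀ {n} → Digraph n → Fin n → Fin n → Bool
δD D a b = ⌊ a <? b ⌋ ∨ arc? D a b

ΨG : ∀ {n} → SimpleGraph n → ℕ → ℕ
ΨG {n} G x = sum (map (λ π → (x + δsum (δG G) π) C n) (orderings n))

-- π = (u_1,…,u_n) ∈ OP(D): (u_i,u_j) ∈ A ⇒ i < j, i.e. no arc from a later to an earlier entry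
-- (and no loop at any entry).
respects : ∀ {n} → Digraph n → List (Fin n) → Bool
respects D []       = true
respects D (u ∷ us) = not (arc? D u u) ∧ allᵇ (λ w → not (arc? D w u)) us ∧ respects D us

OP : ∀ {n} → Digraph n → List (List (Fin n))
OP {n} D = filterᵇ (respects D) (orderings n)

ΨD : ∀ {n} → Digraph n → ℕ → ℕ
ΨD {n} D x = sum (map (λ π → (x + δsum (δD D) π) C n) (OP D))

-- Exchanging the two sums, the right-hand side becomes a sum over orderings π of
-- Σ_{D ∈ AO(G), π ∈ OP(D)} C(x + δ_D(π), n). An ordering π lies in OP(D) for exactly one
-- orientation D of G, namely the one directing every edge from its earlier to its later
-- endpoint in π, and that orientation is acyclic. Along π it has δ_D = δ_G, since an edge
-- between consecutive entries of π is an arc in the forward direction.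

module Submission where

open import Defs hiding (sym)
open import Algebra.Properties.CommutativeSemigroup using (interchange)
open import Data.Bool using (Bool; true; false; _∧_; _∨_; not; if_then_else_)
open import Data.Bool.Properties using (∧-conicalˡ; ∧-conicalʳ; not-injective; not-¬; ¬-not; T-≡)
open import Data.Fin as Fin using (Fin; zero; suc; _≟_; punchOut)
open import Data.Fin.Properties using (pigeonhole; punchOut-injective)
open import Data.List using (List; []; _∷_; map; length; lookup; allFin)
open import Data.List.Membership.Propositional using (_∈_)
open import Data.List.Membership.Propositional.Properties using (∈-lookup; ∈-map⁻; ∈-concatMap⁻)
open import Data.List.Properties using (map-cong; map-cong-local)
import Data.List.Relation.Unary.All as All
open import Data.List.Relation.Unary.Any using (here; there; satisfied; any?)
open import Data.List.Relation.Unary.AllPairs using ([]; _∷_)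
open import Data.List.Relation.Unary.Unique.Propositional using (Unique)
open import Data.Nat using (ℕ; suc; _+_; _<_; _<?_; z<s; s<s; s<s⁻¹)
open import Data.Nat.Combinatorics using (_C_)
open import Data.Nat.ListAction using (sum)
open import Data.Nat.Properties
  using (+-commutativeSemigroup; +-identityʳ; suc-injective; n≮0; n<1+n)
open import Data.Nat.Properties using (<-irrefl; <-trans; <-asym; <-cmp)
open import Data.Product using (_×_; _,_; proj₁; proj₂; map₂)
open import Data.Sum using (_⊎_; inj₁; inj₂)
open import Data.Vec as Vec using (tabulate)
open import Data.Vec.Properties using (lookup∘tabulate; tabulate∘lookup; tabulate-cong)
open import Function using (_∘_)
open import Function.Bundles using (_⇔_; module Equivalence)
open import Function.Definitions using (Injective)
open import Relation.Binary.Definitions using (tri<; tri≈; tri>)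
open import Relation.Binary.PropositionalEquality
  using (_≡_; _≢_; refl; sym; trans; cong; cong₂; subst; subst₂; module ≡-Reasoning)
open import Relation.Nullary using (¬_; yes; no; contradiction)
open import Relation.Nullary.Decidable using (Dec; ⌊_⌋; isYes≗does; dec-true; dec-false; toWitness)

private
  variable
    A : Set
    n : ℕ

∧≡true⁻ : ∀ {a b} → a ∧ b ≡ true → a ≡ true × b ≡ true
∧≡true⁻ {a} {b} e = ∧-conicalˡ a b e , ∧-conicalʳ a b e

not≡true⇒≢true : ∀ {b} → not b ≡ true → b ≢ true
not≡true⇒≢true e b≡true = not-¬ b≡true (not-injective e)

≢true⇒not≡true : ∀ {b} → b ≢ true → not b ≡ true
≢true⇒not≡true b≢true = cong not (¬-not b≢true)

⌊⌋-true : ∀ {P : Set} (p? : Dec P) → P → ⌊ p? ⌋ ≡ true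
⌊⌋-true p? p = trans (isYes≗does p?) (dec-true p? p)

⌊⌋-false : ∀ {P : Set} (p? : Dec P) → ¬ P → ⌊ p? ⌋ ≡ false
⌊⌋-false p? ¬p = trans (isYes≗does p?) (dec-false p? ¬p)

⌊⌋≡true⇒ : ∀ {P : Set} (p? : Dec P) → ⌊ p? ⌋ ≡ true → P
⌊⌋≡true⇒ p? e = toWitness {a? = p?} (Equivalence.from T-≡ e)

allᵇ⁻ : ∀ (p : A → Bool) {xs x} → allᵇ p xs ≡ true → x ∈ xs → p x ≡ true
allᵇ⁻ p {y ∷ ys} e (here refl) = proj₁ (∧≡true⁻ e)
allᵇ⁻ p {y ∷ ys} e (there x∈) = allᵇ⁻ p (proj₂ (∧≡true⁻ e)) x∈

allᵇ⁺ : ∀ (p : A → Bool) {xs} → (∀ {x} → x ∈ xs → p x ≡ true) → allᵇ p xs ≡ true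
allᵇ⁺ p {[]} _ = refl
allᵇ⁺ p {y ∷ ys} h = cong₂ _∧_ (h (here refl)) (allᵇ⁺ p (h ∘ there))

∈-filterᵇ⁻ : ∀ (p : A → Bool) xs {x} → x ∈ filterᵇ p xs → p x ≡ true × x ∈ xs
∈-filterᵇ⁻ p (y ∷ ys) x∈ with p y in py | x∈
... | true  | here refl = py , here refl
... | true  | there x∈′ = map₂ there (∈-filterᵇ⁻ p ys x∈′)
... | false | x∈′       = map₂ there (∈-filterᵇ⁻ p ys x∈′)

sum-map-filterᵇ : ∀ (p : A → Bool) (f : A → ℕ) xs →
  sum (map f (filterᵇ p xs)) ≡ sum (map (λ x → if p x then f x else 0) xs)
sum-map-filterᵇ p f [] = refl
sum-map-filterᵇ p f (x ∷ xs) with p x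
... | true  = cong (f x +_) (sum-map-filterᵇ p f xs)
... | false = sum-map-filterᵇ p f xs

sum-map-+ : ∀ (f g : A → ℕ) xs → sum (map (λ x → f x + g x) xs) ≡ sum (map f xs) + sum (map g xs)
sum-map-+ f g [] = refl
sum-map-+ f g (x ∷ xs) =
  trans (cong (f x + g x +_) (sum-map-+ f g xs))
        (interchange +-commutativeSemigroup (f x) (g x) _ _)

sum-map-zero : ∀ (xs : List A) → sum (map (λ _ → 0) xs) ≡ 0
sum-map-zero [] = refl
sum-map-zero (x ∷ xs) = sum-map-zero xs

sum-map-swap : ∀ {B : Set} (f : A → B → ℕ) xs ys →
  sum (map (λ x → sum (map (f x) ys)) xs) ≡ sum (map (λ y → sum (map (λ x → f x y) xs)) ys)
sum-map-swap f [] ys = sym (sum-map-zero ys)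
sum-map-swap f (x ∷ xs) ys =
  trans (cong (sum (map (f x) ys) +_) (sum-map-swap f xs ys))
        (sym (sum-map-+ (f x) (λ y → sum (map (λ x → f x y) xs)) ys))

sum-map-if-false : ∀ (p : A → Bool) (f : A → ℕ) {xs} → (∀ {x} → x ∈ xs → p x ≡ false) →
  sum (map (λ x → if p x then f x else 0) xs) ≡ 0
sum-map-if-false p f {[]} _ = refl
sum-map-if-false p f {x ∷ xs} h rewrite h (here refl) = sum-map-if-false p f (h ∘ there)

sum-map-if-unique : ∀ (p : A → Bool) (f : A → ℕ) {xs d} → Unique xs → d ∈ xs → p d ≡ true →
  (∀ {x} → x ∈ xs → p x ≡ true → x ≡ d) →
  sum (map (λ x → if p x then f x else 0) xs) ≡ f d
sum-map-if-unique p f {x ∷ xs} (x∉xs ∷ _) (here refl) pd only rewrite pd =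
  trans (cong (f x +_) (sum-map-if-false p f others)) (+-identityʳ (f x))
  where
  others : ∀ {y} → y ∈ xs → p y ≡ false
  others {y} y∈ = ¬-not λ py → All.lookup x∉xs y∈ (sym (only (there y∈) py))
sum-map-if-unique p f {x ∷ xs} (x∉xs ∷ uq) (there d∈) pd only
  rewrite ¬-not {p x} (λ px → All.lookup x∉xs d∈ (only (here refl) px)) =
  sum-map-if-unique p f uq d∈ pd (only ∘ there)

Unique⇒lookup-injective : ∀ {xs : List A} → Unique xs →
  ∀ {i j} → i Fin.< j → lookup xs i ≢ lookup xs j
Unique⇒lookup-injective (x∉xs ∷ _) {zero}  {suc j} _         = All.lookup x∉xs (∈-lookup j)
Unique⇒lookup-injective (_ ∷ uq)    {suc i} {suc j} (s<s i<j) = Unique⇒lookup-injective uq i<j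

Unique-length⇒enumerates : ∀ {π : List (Fin n)} → Unique π → length π ≡ n → ∀ v → v ∈ π
Unique-length⇒enumerates {suc k} {π} uq len v with any? (v ≟_) π
... | yes v∈π = v∈π
... | no v∉π =
  let i , j , i<j , eq = pigeonhole (subst (k <_) (sym len) (n<1+n k)) (λ i → punchOut (v≢ i))
  in contradiction (punchOut-injective (v≢ i) (v≢ j) eq) (Unique⇒lookup-injective uq i<j)
  where
  v≢ : ∀ i → v ≢ lookup π i
  v≢ i v≡ = v∉π (subst (_∈ π) (sym v≡) (∈-lookup i))

∈-words⇒length : ∀ k {π : List (Fin n)} → π ∈ words k → length π ≡ k
∈-words⇒length 0 (here refl) = refl
∈-words⇒length (suc k) π∈
  with satisfied (∈-concatMap⁻ (λ u → map (u ∷_) (words k)) {xs = allFin _} π∈)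
... | u , π∈map with ∈-map⁻ (u ∷_) π∈map
...   | ρ , ρ∈ , refl = cong suc (∈-words⇒length k ρ∈)

distinct⇒Unique : ∀ (π : List (Fin n)) → distinct π ≡ true → Unique π
distinct⇒Unique [] _ = []
distinct⇒Unique (u ∷ us) d with ∧≡true⁻ d
... | fresh , rest = All.tabulate u≢ ∷ distinct⇒Unique us rest
  where
  u≢ : ∀ {w} → w ∈ us → u ≢ w
  u≢ w∈ u≡w = not≡true⇒≢true (allᵇ⁻ _ fresh w∈) (⌊⌋-true (u ≟ _) u≡w)

∈-orderings⁻ : ∀ {π} → π ∈ orderings n → Unique π × length π ≡ n
∈-orderings⁻ {n} π∈ with ∈-filterᵇ⁻ distinct (words n) π∈
... | d , π∈words = distinct⇒Unique _ d , ∈-words⇒length n π∈words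

position : List (Fin n) → Fin n → ℕ
position []       a = 0
position (u ∷ us) a = if ⌊ u ≟ a ⌋ then 0 else suc (position us a)

position-here : ∀ (u : Fin n) us → position (u ∷ us) u ≡ 0
position-here u us rewrite ⌊⌋-true (u ≟ u) refl = refl

position-there : ∀ {u a : Fin n} us → u ≢ a → position (u ∷ us) a ≡ suc (position us a)
position-there {u = u} {a} us u≢a rewrite ⌊⌋-false (u ≟ a) u≢a = refl

position-injective : ∀ {l : List (Fin n)} {a b} → a ∈ l → position l a ≡ position l b → a ≡ b
position-injective {l = u ∷ us} {a} {b} a∈ eq with u ≟ a | u ≟ b | a∈
... | yes refl | yes refl | _          = refl
... | no u≢a   | _        | here refl  = contradiction refl u≢a
... | no _     | no _     | there a∈us = position-injective a∈us (suc-injective eq)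

respects-∷⁻ : ∀ {D : Digraph n} {u us} → respects D (u ∷ us) ≡ true →
  ¬ Arc D u u × (∀ {w} → w ∈ us → ¬ Arc D w u) × respects D us ≡ true
respects-∷⁻ {D = D} {u} {us} r =
  let noLoop , rest = ∧≡true⁻ {not (arc? D u u)} r
      noBack , rs   = ∧≡true⁻ {allᵇ noArcTo us} rest
  in not≡true⇒≢true noLoop , (not≡true⇒≢true ∘ allᵇ⁻ noArcTo noBack) , rs
  where
  noArcTo : Fin _ → Bool
  noArcTo w = not (arc? D w u)

respects-∷⁺ : ∀ {D : Digraph n} {u us} → ¬ Arc D u u → (∀ {w} → w ∈ us → ¬ Arc D w u) →
  respects D us ≡ true → respects D (u ∷ us) ≡ true
respects-∷⁺ {D = D} {u} noLoop noBack rs =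
  cong₂ _∧_ (≢true⇒not≡true noLoop)
            (cong₂ _∧_ (allᵇ⁺ (λ w → not (arc? D w u)) (≢true⇒not≡true ∘ noBack)) rs)

ArcsForward : Digraph n → List (Fin n) → Set
ArcsForward D l = ∀ {a b} → a ∈ l → b ∈ l → Arc D a b → position l a < position l b

respects⇒ArcsForward : ∀ {D : Digraph n} {l} → Unique l → respects D l ≡ true → ArcsForward D l
respects⇒ArcsForward {D = D} {l = u ∷ us} (u∉us ∷ uq) r a∈ b∈ arc
  with respects-∷⁻ {D = D} {u} r | a∈ | b∈
... | noLoop , _ , _ | here refl | here refl = contradiction arc noLoop
... | _ , noBack , _ | there a∈us | here refl = contradiction arc (noBack a∈us)
... | _ | here refl | there b∈us
  rewrite position-here u us | position-there us (All.lookup u∉us b∈us) = z<s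
... | _ , _ , rs | there a∈us | there b∈us
  rewrite position-there us (All.lookup u∉us a∈us) | position-there us (All.lookup u∉us b∈us) =
  s<s (respects⇒ArcsForward uq rs a∈us b∈us arc)

ArcsForward⇒respects : ∀ {D : Digraph n} {l} → Unique l → ArcsForward D l → respects D l ≡ true
ArcsForward⇒respects {l = []} _ _ = refl
ArcsForward⇒respects {D = D} {l = u ∷ us} (u∉us ∷ uq) fwd =
  respects-∷⁺ {D = D} noLoop noBack (ArcsForward⇒respects uq fwd-us)
  where
  noLoop : ¬ Arc D u u
  noLoop arc = <-irrefl refl (fwd (here refl) (here refl) arc)
  noBack : ∀ {w} → w ∈ us → ¬ Arc D w u
  noBack {w} w∈ arc =
    n≮0 (subst (position (u ∷ us) w <_) (position-here u us) (fwd (there w∈) (here refl) arc))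
  fwd-us : ArcsForward D us
  fwd-us a∈ b∈ arc = s<s⁻¹ (subst₂ _<_ (position-there us (All.lookup u∉us a∈))
                                        (position-there us (All.lookup u∉us b∈))
                                        (fwd (there a∈) (there b∈) arc))

tabulate-arc? : ∀ (D : Digraph n) → tabulate (λ a → tabulate (λ b → arc? D a b)) ≡ D
tabulate-arc? D = trans (tabulate-cong (tabulate∘lookup ∘ Vec.lookup D)) (tabulate∘lookup D)

module _ (G : SimpleGraph n) where

  orientBy : (Fin n → ℕ) → Digraph n
  orientBy r = tabulate λ a → tabulate λ b → adj G a b ∧ ⌊ r a <? r b ⌋

  arc?-orientBy : ∀ r a b → arc? (orientBy r) a b ≡ adj G a b ∧ ⌊ r a <? r b ⌋
  arc?-orientBy r a b =
    trans (cong (λ row → Vec.lookup row b) (lookup∘tabulate _ a)) (lookup∘tabulate _ b)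

  Arc-orientBy⁺ : ∀ {r a b} → Edge G a b → r a < r b → Arc (orientBy r) a b
  Arc-orientBy⁺ {r} {a} {b} edge lt =
    trans (arc?-orientBy r a b) (cong₂ _∧_ edge (⌊⌋-true (r a <? r b) lt))

  Arc-orientBy⁻ : ∀ {r a b} → Arc (orientBy r) a b → Edge G a b × r a < r b
  Arc-orientBy⁻ {r} {a} {b} arc =
    let edge , lt = ∧≡true⁻ {adj G a b} (trans (sym (arc?-orientBy r a b)) arc)
    in edge , ⌊⌋≡true⇒ (r a <? r b) lt

  Path-orientBy⇒< : ∀ {r a b} → Path (orientBy r) a b → r a < r b
  Path-orientBy⇒< (step arc)   = proj₂ (Arc-orientBy⁻ arc)
  Path-orientBy⇒< (arc ∷ₚ p) = <-trans (proj₂ (Arc-orientBy⁻ arc)) (Path-orientBy⇒< p)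

  orientBy-acyclic : ∀ r → Acyclic (orientBy r)
  orientBy-acyclic r v cycle = <-irrefl refl (Path-orientBy⇒< cycle)

  orientBy-isOrientation : ∀ {r} → Injective _≡_ _≡_ r → IsOrientation G (orientBy r)
  orientBy-isOrientation {r} r-injective u v = proj₁ ∘ Arc-orientBy⁻ , edge⇒arc , antisym
    where
    edge⇒arc : Edge G u v → Arc (orientBy r) u v ⊎ Arc (orientBy r) v u
    edge⇒arc edge with <-cmp (r u) (r v)
    ... | tri< lt _ _ = inj₁ (Arc-orientBy⁺ edge lt)
    ... | tri> _ _ gt = inj₂ (Arc-orientBy⁺ (trans (SimpleGraph.sym G v u) edge) gt)
    ... | tri≈ _ eq _ with r-injective eq
    ...   | refl = contradiction (trans (sym (irrefl G u)) edge) λ ()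
    antisym : ¬ (Arc (orientBy r) u v × Arc (orientBy r) v u)
    antisym (uv , vu) = <-asym (proj₂ (Arc-orientBy⁻ uv)) (proj₂ (Arc-orientBy⁻ vu))

  forward-orientation≡orientBy : ∀ {D r} → IsOrientation G D → (∀ {a b} → Arc D a b → r a < r b) →
    D ≡ orientBy r
  forward-orientation≡orientBy {D} {r} orientation forward =
    trans (sym (tabulate-arc? D)) (tabulate-cong λ a → tabulate-cong (arc?≡ a))
    where
    arc?≡ : ∀ a b → arc? D a b ≡ adj G a b ∧ ⌊ r a <? r b ⌋
    arc?≡ a b with arc? D a b in arc
    ... | true = sym (cong₂ _∧_ (proj₁ (orientation a b) arc) (⌊⌋-true (r a <? r b) (forward arc)))
    ... | false with adj G a b in edge
    ...   | false = refl
    ...   | true with proj₁ (proj₂ (orientation a b)) edge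
    ...     | inj₁ arc′ = contradiction (trans (sym arc) arc′) λ ()
    ...     | inj₂ back = sym (⌊⌋-false (r a <? r b) (<-asym (forward back)))

  arc?≡adj : ∀ {D u v} → IsOrientation G D → ¬ Arc D v u → arc? D u v ≡ adj G u v
  arc?≡adj {D} {u} {v} orientation noBack with arc? D u v in arc | adj G u v in edge
  ... | true  | true  = refl
  ... | false | false = refl
  ... | true  | false = trans (sym (proj₁ (orientation u v) arc)) edge
  ... | false | true with proj₁ (proj₂ (orientation u v)) edge
  ...   | inj₁ arc′ = trans (sym arc) arc′
  ...   | inj₂ back = contradiction back noBack

  δD≡δG : ∀ {D u v} → IsOrientation G D → ¬ Arc D v u → δD D u v ≡ δG G u v
  δD≡δG {D} {u} {v} orientation noBack = cong (⌊ u Fin.<? v ⌋ ∨_) (arc?≡adj {D} orientation noBack)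

  δsum-δD≡δG : ∀ {D} → IsOrientation G D → ∀ l → respects D l ≡ true → δsum (δD D) l ≡ δsum (δG G) l
  δsum-δD≡δG orientation []           _ = refl
  δsum-δD≡δG orientation (u ∷ [])     _ = refl
  δsum-δD≡δG {D} orientation (u ∷ v ∷ us) r =
    let _ , noBack , rs = respects-∷⁻ {D = D} {u} {v ∷ us} r
    in cong₂ _+_ (cong (λ δ → if δ then 1 else 0) (δD≡δG {D} orientation (noBack (here refl))))
                 (δsum-δD≡δG {D} orientation (v ∷ us) rs)

  inducedOrientation : List (Fin n) → Digraph n
  inducedOrientation π = orientBy (position π)

  module _ {π : List (Fin n)} (π-unique : Unique π) (π-enumerates : ∀ v → v ∈ π) where

    inducedOrientation-isAcyclicOrientation : IsAcyclicOrientation G (inducedOrientation π)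
    inducedOrientation-isAcyclicOrientation =
      orientBy-isOrientation (position-injective (π-enumerates _)) , orientBy-acyclic (position π)

    respects-inducedOrientation : respects (inducedOrientation π) π ≡ true
    respects-inducedOrientation =
      ArcsForward⇒respects π-unique λ _ _ arc → proj₂ (Arc-orientBy⁻ arc)

    respects⇒≡inducedOrientation : ∀ {D} → IsOrientation G D → respects D π ≡ true →
      D ≡ inducedOrientation π
    respects⇒≡inducedOrientation orientation r =
      forward-orientation≡orientBy orientation
        (respects⇒ArcsForward π-unique r (π-enumerates _) (π-enumerates _))

    sum-if-respects : ∀ {AO} → Unique AO → (∀ D → D ∈ AO ⇔ IsAcyclicOrientation G D) →
      (f : Digraph n → ℕ) →
      sum (map (λ D → if respects D π then f D else 0) AO) ≡ f (inducedOrientation π)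
    sum-if-respects AO-unique AO-spec f =
      sum-map-if-unique (λ D → respects D π) f AO-unique
        (Equivalence.from (AO-spec _) inducedOrientation-isAcyclicOrientation)
        respects-inducedOrientation
        (λ D∈ → respects⇒≡inducedOrientation (proj₁ (Equivalence.to (AO-spec _) D∈)))

lemma4p2 : ∀ {n} (G : SimpleGraph n) (AO : List (Digraph n)) →
    Unique AO → (∀ D → D ∈ AO ⇔ IsAcyclicOrientation G D) →
    ∀ (x : ℕ) → ΨG G x ≡ sum (map (λ D → ΨD D x) AO)
lemma4p2 {n} G AO AO-unique AO-spec x = begin
  ΨG G x
    ≡⟨ cong sum (map-cong-local (All.tabulate (sym ∘ sum-over-AO))) ⟩
  sum (map (λ π → sum (map (λ D → term D π) AO)) (orderings n))
    ≡⟨ sum-map-swap term AO (orderings n) ⟨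
  sum (map (λ D → sum (map (term D) (orderings n))) AO)
    ≡⟨ cong sum (map-cong (λ D → sym (sum-map-filterᵇ (respects D) (binom D) (orderings n))) AO) ⟩
  sum (map (λ D → ΨD D x) AO) ∎
  where
  open ≡-Reasoning
  binom : Digraph n → List (Fin n) → ℕ
  binom D π = (x + δsum (δD D) π) C n
  term : Digraph n → List (Fin n) → ℕ
  term D π = if respects D π then binom D π else 0
  sum-over-AO : ∀ {π} → π ∈ orderings n → sum (map (λ D → term D π) AO) ≡ (x + δsum (δG G) π) C n
  sum-over-AO {π} π∈ =
    let π-unique , π-length = ∈-orderings⁻ π∈
        π-enumerates = Unique-length⇒enumerates π-unique π-length
        D-isAO = inducedOrientation-isAcyclicOrientation G π-unique π-enumerates
        respects-D = respects-inducedOrientation G π-unique π-enumerates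
    in trans (sum-if-respects G π-unique π-enumerates AO-unique AO-spec (λ D → binom D π))
             (cong (λ k → (x + k) C n) (δsum-δD≡δG G (proj₁ D-isAO) π respects-D))
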